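{- For any positive integer $k$, the signed projective cube $SPC(k)$ is triple-transitive in the following sense. Let $\{x,y,z\}$ and $\{u,v,t\}$ be two triples of distinct vertices of $SPC(k)$. If after a switching (i.e. after replacing, for the pairs having exactly one endpoint in some chosen subset of $\{x,y,z\}$, the set $S^-$ by its complement $S^+$) we have $$(|S^-(x,y)|,|S^-(y,z)|,|S^-(z,x)|)=(|S^-(u,v)|,|S^-(v,t)|,|S^-(t,u)|),$$ then there is an automorphism of $SPC(k)$ mapping $x,y,z$ to $u,v,t$ respectively.
   Context: The signed projective cube $SPC(n)$ is the signed graph with vertex set $\mathbb{Z}_2^n$ in which two vertices at Hamming distance $1$ are joined by a positive edge and two vertices at Hamming distance $n$ are joined by a negative edge. Let $e_1,\dots,e_n$ be the standard basis of $\mathbb{Z}_2^n$, $J=11\cdots1$, and $S_n=\{e_1,\dots,e_n,J\}$. For two vertices $p,q$ there are exactly two subsets of $S_n$ whose sum (in $\mathbb{Z}_2^n$) equals $p+q$, and they are complementary in $S_n$; $S^-(p,q)$ denotes the one containing $J$ and $S^+(p,q)$ the one not containing $J$. Switching at a vertex $p$ interchanges the roles of $S^+(p,q)$ and $S^-(p,q)$ for all $q$. An automorphism of a signed graph is a bijection of its vertex set which, after a switching, maps edges onto edges preserving signs (i.e. an invertible signed-graph homomorphism onto itself, switching allowed). -}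

module Defs where

open import Data.Nat using (ℕ; suc)
open import Data.Bool using (Bool; true; false; not; _xor_; if_then_else_)
open import Data.Vec using (Vec; []; _∷_; zipWith; map; count)
open import Data.Fin.Subset using (Subset; inside; outside)
open import Relation.Binary.PropositionalEquality using (_≡_)
open import Relation.Nullary using (Dec; yes; no)
open import Function.Bundles using (_⤖_; _⇔_; Bijection)
open import Data.Product using (Σ)

Vertex : ℕ → Set
Vertex k = Vec Bool k

_⊕_ : ∀ {k} → Vertex k → Vertex k → Vertex k
p ⊕ q = zipWith _xor_ p q

ham : ∀ {k} → Vertex k → Vertex k → ℕ
ham p q = count (λ b → isTrue b) (p ⊕ q)
  where
  isTrue : (b : Bool) → Dec (b ≡ true)
  isTrue true = yes _≡_.refl
  isTrue false = no (λ ())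

-- S_k = {J, e_1, ..., e_k} is indexed by Fin (suc k): index zero is J,
-- index suc i is e_(i+1).
-- S⁺(p,q) = {e_i : p_i ≠ q_i}  (sums to p+q, does not contain J)
-- S⁻(p,q) = {J} ∪ {e_i : p_i = q_i}  (its complement in S_k, contains J)
S⁺ : ∀ {k} → Vertex k → Vertex k → Subset (suc k)
S⁺ p q = outside ∷ map (λ b → if b then inside else outside) (p ⊕ q)

S⁻ : ∀ {k} → Vertex k → Vertex k → Subset (suc k)
S⁻ p q = inside ∷ map (λ b → if b then outside else inside) (p ⊕ q)

-- The S⁻ of a pair after switching: if the pair has exactly one endpoint
-- in the switching set (flip = true), S⁻ is replaced by its complement S⁺.
switchedS⁻ : ∀ {k} → Bool → Vertex k → Vertex k → Subset (suc k)
switchedS⁻ flip p q = if flip then S⁺ p q else S⁻ p q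

-- Signs: false = positive, true = negative.
Edge : (k : ℕ) → Bool → Vertex k → Vertex k → Set
Edge k false p q = ham p q ≡ 1
Edge k true  p q = ham p q ≡ k

-- Automorphism: a bijection φ of the vertex set such that, after switching
-- at the vertex set σ (σ p = true iff p is switched), φ maps edges onto
-- edges preserving signs.
IsAutomorphism : (k : ℕ) → (Vertex k ⤖ Vertex k) → Set
IsAutomorphism k φ =
  Σ (Vertex k → Bool) (λ σ → ∀ (s : Bool) (p q : Vertex k) →
     Edge k s p q ⇔ Edge k (s xor σ p xor σ q) (f p) (f q))
  where
  f = Bijection.to φ

-- The pair set S⁺(p,q) satisfies S⁺(x,p) ⊕ S⁺(x,q) = S⁺(p,q), and p, q
-- span an edge of sign s iff S⁺(p,q), complemented when s is negative, is a singleton. So a permutation π of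
-- S_k and base points x ↦ u induce an automorphism: p goes to the unique r such that π S⁺(x,p) is S⁺(u,r) or
-- its complement, and the switching at p records which of the two it is. For the triple it remains to find π
-- sending the switched sets of (x,y) and (x,z) to S⁺(u,v) and S⁺(u,t) at once. It exists because the four
-- cells of the Venn diagram of two sets A, B have sizes determined by |A|, |B| and |A ⊕ B|, and these are
-- the three weights compared in the hypothesis (as S⁺(x,y) ⊕ S⁺(x,z) = S⁺(y,z)).

module Submission where

open import Defs
open import Data.Nat using (ℕ; _≤_; zero; suc; _+_; _*_; _∸_; _<_; z<s)
open import Data.Bool using (Bool; _xor_; true; false; not; if_then_else_)
open import Data.Product using (Σ; _×_; ∃; _,_; proj₁; proj₂)
open import Data.Fin.Subset using (∣_∣)
open import Relation.Binary.PropositionalEquality using (_≡_; _≢_)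
open import Function.Bundles using (_⤖_; Bijection)

open import Data.Bool.Properties using (_≟_; xor-assoc; xor-comm; xor-identityˡ; xor-identityʳ; xor-same)
open import Data.Fin using (Fin; zero; suc; punchIn)
open import Data.Fin.Permutation as Perm
  using (Permutation′; _⟨$⟩ʳ_; flip; inverseˡ; inverseʳ; insert; remove; insert-punchIn; insert-remove)
open import Data.Fin.Subset using (Subset; outside; inside; ∁; ⊥)
open import Data.Fin.Subset.Properties using (∣p∣≤n; ∣∁p∣≡n∸∣p∣)
open import Data.Nat.Properties
  using (suc-injective; +-suc; +-cancelˡ-≡; +-cancelʳ-≡; *-cancelˡ-≡; ∸-cancelˡ-≡; m+n∸n≡m; m≤n⇒m≤1+n; ≤-refl)
open import Data.Nat.Tactic.RingSolver using (solve-∀)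
open import Data.Product.Properties using (≡-dec)
open import Data.Vec
  using (Vec; []; _∷_; head; map; zip; zipWith; replicate; lookup; tabulate; insertAt; removeAt; count)
open import Data.Vec.Properties
  using (lookup∘tabulate; tabulate-cong; lookup-zipWith; lookup-map; lookup-replicate; insertAt-punchIn; insertAt-removeAt;
         map-proj₁-zip; map-proj₂-zip; map-cong; map-∘; map-id;
         zipWith-assoc; zipWith-comm; zipWith-identityˡ; zipWith-replicate; zipWith-replicate₁)
open import Data.Vec.Relation.Binary.Pointwise.Extensional using (ext; Pointwise-≡⇒≡)
open import Function using (id; _∘_)
open import Function.Bundles using (_⇔_; mk⇔; mk↔ₛ′)
open import Function.Properties.Inverse using (↔⇒⤖)
import Function.Properties.Equivalence as ⇔
open import Level using (Level)
open import Relation.Binary.Definitions using (DecidableEquality)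
open import Relation.Binary.PropositionalEquality
  using (refl; sym; trans; cong; cong₂; subst; subst₂; module ≡-Reasoning)
open import Relation.Nullary using (yes; no; does)
open import Relation.Nullary.Decidable using (dec-true; does-≡)
open import Relation.Unary using (Pred; Decidable)

open ≡-Reasoning

private
  variable
    a b c p : Level
    A : Set a
    B : Set b
    C : Set c
    n : ℕ

-- Permutations and multiplicities

permute : Permutation′ n → Vec A n → Vec A n
permute π xs = tabulate (λ i → lookup xs (π ⟨$⟩ʳ i))

lookup-permute : ∀ (π : Permutation′ n) (xs : Vec A n) i → lookup (permute π xs) i ≡ lookup xs (π ⟨$⟩ʳ i)
lookup-permute π xs = lookup∘tabulate _

permute-cong : ∀ (π ρ : Permutation′ n) → π Perm.≈ ρ → ∀ (xs : Vec A n) → permute π xs ≡ permute ρ xs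
permute-cong π ρ π≈ρ xs = tabulate-cong (cong (lookup xs) ∘ π≈ρ)

permute-inverse : ∀ (π ρ : Permutation′ n) → (∀ i → ρ ⟨$⟩ʳ (π ⟨$⟩ʳ i) ≡ i) →
                  ∀ (xs : Vec A n) → permute π (permute ρ xs) ≡ xs
permute-inverse π ρ ρ∘π≗id xs = Pointwise-≡⇒≡ (ext λ i → begin
  lookup (permute π (permute ρ xs)) i ≡⟨ lookup-permute π (permute ρ xs) i ⟩
  lookup (permute ρ xs) (π ⟨$⟩ʳ i)    ≡⟨ lookup-permute ρ xs (π ⟨$⟩ʳ i) ⟩
  lookup xs (ρ ⟨$⟩ʳ (π ⟨$⟩ʳ i))        ≡⟨ cong (lookup xs) (ρ∘π≗id i) ⟩
  lookup xs i                         ∎)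

permute-replicate : ∀ (π : Permutation′ n) (x : A) → permute π (replicate n x) ≡ replicate n x
permute-replicate π x = Pointwise-≡⇒≡ (ext λ i →
  trans (lookup-permute π (replicate _ x) i)
        (trans (lookup-replicate (π ⟨$⟩ʳ i) x) (sym (lookup-replicate i x))))

permute-zipWith : ∀ (f : A → B → C) (π : Permutation′ n) xs ys →
                  permute π (zipWith f xs ys) ≡ zipWith f (permute π xs) (permute π ys)
permute-zipWith f π xs ys = Pointwise-≡⇒≡ (ext λ i → begin
  lookup (permute π (zipWith f xs ys)) i
    ≡⟨ lookup-permute π (zipWith f xs ys) i ⟩
  lookup (zipWith f xs ys) (π ⟨$⟩ʳ i)
    ≡⟨ lookup-zipWith f _ xs ys ⟩
  f (lookup xs (π ⟨$⟩ʳ i)) (lookup ys (π ⟨$⟩ʳ i))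
    ≡⟨ cong₂ f (lookup-permute π xs i) (lookup-permute π ys i) ⟨
  f (lookup (permute π xs) i) (lookup (permute π ys) i)
    ≡⟨ lookup-zipWith f i (permute π xs) (permute π ys) ⟨
  lookup (zipWith f (permute π xs) (permute π ys)) i
    ∎)

permute-map : ∀ (f : A → B) (π : Permutation′ n) xs →
              permute π (map f xs) ≡ map f (permute π xs)
permute-map f π xs = Pointwise-≡⇒≡ (ext λ i → begin
  lookup (permute π (map f xs)) i ≡⟨ lookup-permute π (map f xs) i ⟩
  lookup (map f xs) (π ⟨$⟩ʳ i)    ≡⟨ lookup-map _ f xs ⟩
  f (lookup xs (π ⟨$⟩ʳ i))        ≡⟨ cong f (lookup-permute π xs i) ⟨
  f (lookup (permute π xs) i)     ≡⟨ lookup-map i f (permute π xs) ⟨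
  lookup (map f (permute π xs)) i ∎)

lookup-removeAt : ∀ (xs : Vec A (suc n)) j i → lookup (removeAt xs j) i ≡ lookup xs (punchIn j i)
lookup-removeAt xs j i = begin
  lookup (removeAt xs j) i
    ≡⟨ insertAt-punchIn _ j _ i ⟨
  lookup (insertAt (removeAt xs j) j (lookup xs j)) (punchIn j i)
    ≡⟨ cong (λ ys → lookup ys (punchIn j i)) (insertAt-removeAt xs j) ⟩
  lookup xs (punchIn j i)
    ∎

permute-insert : ∀ (π : Permutation′ n) (xs : Vec A (suc n)) j →
                 permute (insert zero j π) xs ≡ lookup xs j ∷ permute π (removeAt xs j)
permute-insert π xs j = cong (lookup xs j ∷_) (tabulate-cong λ i → begin
  lookup xs (insert zero j π ⟨$⟩ʳ suc i) ≡⟨ cong (lookup xs) (insert-punchIn zero j π i) ⟩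
  lookup xs (punchIn j (π ⟨$⟩ʳ i))       ≡⟨ lookup-removeAt xs j _ ⟨
  lookup (removeAt xs j) (π ⟨$⟩ʳ i)      ∎)

module _ {P : Pred A p} (P? : Decidable P) where

  count-yes : ∀ {x} (xs : Vec A n) → P x → count P? (x ∷ xs) ≡ suc (count P? xs)
  count-yes {x = x} xs px rewrite dec-true (P? x) px = refl

  count-∷-cong : ∀ x (xs ys : Vec A n) → count P? xs ≡ count P? ys → count P? (x ∷ xs) ≡ count P? (x ∷ ys)
  count-∷-cong x xs ys = cong (if does (P? x) then suc else id)

  count-∷-cancel : ∀ x (xs ys : Vec A n) → count P? (x ∷ xs) ≡ count P? (x ∷ ys) → count P? xs ≡ count P? ys
  count-∷-cancel x xs ys eq with does (P? x)
  ... | true  = suc-injective eq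
  ... | false = eq

  count-insertAt : ∀ (xs : Vec A n) j v → count P? (insertAt xs j v) ≡ count P? (v ∷ xs)
  count-insertAt xs       zero    v = refl
  count-insertAt (x ∷ xs) (suc j) v
    rewrite count-insertAt xs j v with does (P? x) | does (P? v)
  ... | false | _     = refl
  ... | true  | true  = refl
  ... | true  | false = refl

  count-removeAt : ∀ (xs : Vec A (suc n)) j → count P? xs ≡ count P? (lookup xs j ∷ removeAt xs j)
  count-removeAt xs j =
    trans (cong (count P?) (sym (insertAt-removeAt xs j))) (count-insertAt (removeAt xs j) j (lookup xs j))

  count-permute : ∀ (π : Permutation′ n) (xs : Vec A n) → count P? (permute π xs) ≡ count P? xs
  count-permute {zero}  π []  = refl
  count-permute {suc n} π xs = begin
    count P? (permute π xs)
      ≡⟨ cong (count P?) (permute-cong π₀ π (insert-remove zero π) xs) ⟨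
    count P? (permute π₀ xs)
      ≡⟨ cong (count P?) (permute-insert π′ xs j) ⟩
    count P? (lookup xs j ∷ permute π′ xs′)
      ≡⟨ count-∷-cong (lookup xs j) (permute π′ xs′) xs′ (count-permute π′ xs′) ⟩
    count P? (lookup xs j ∷ xs′)
      ≡⟨ count-removeAt xs j ⟨
    count P? xs
      ∎
    where
    j : Fin (suc n)
    j = π ⟨$⟩ʳ zero
    π′ : Permutation′ n
    π′ = remove zero π
    π₀ : Permutation′ (suc n)
    π₀ = insert zero j π′
    xs′ : Vec A n
    xs′ = removeAt xs j

  ∃-lookup-of-count : ∀ (xs : Vec A n) → 0 < count P? xs → ∃ λ j → P (lookup xs j)
  ∃-lookup-of-count (x ∷ xs) pos with P? x
  ... | yes px = zero , px
  ... | no _   = let j , pⱼ = ∃-lookup-of-count xs pos in suc j , pⱼ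

count-cong : ∀ {P : Pred A p} (P? Q? : Decidable P) (xs : Vec A n) →
             count P? xs ≡ count Q? xs
count-cong P? Q? []       = refl
count-cong P? Q? (x ∷ xs) =
  cong₂ (λ b m → (if b then suc else id) m) (does-≡ (P? x) (Q? x)) (count-cong P? Q? xs)

permute-of-counts : ∀ (_≟_ : DecidableEquality A) (xs ys : Vec A n) →
                    (∀ y → count (_≟ y) xs ≡ count (_≟ y) ys) → ∃ λ π → permute π xs ≡ ys
permute-of-counts _≟_ [] [] _ = Perm.id , refl
permute-of-counts _≟_ xs (y ∷ ys) same =
  let j , xⱼ≡y = ∃-lookup-of-count (_≟ y) xs y∈xs
      π , πxs′≡ys = permute-of-counts _≟_ (removeAt xs j) ys (same′ j xⱼ≡y)
  in insert zero j π , (begin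
    permute (insert zero j π) xs            ≡⟨ permute-insert π xs j ⟩
    lookup xs j ∷ permute π (removeAt xs j) ≡⟨ cong₂ _∷_ xⱼ≡y πxs′≡ys ⟩
    y ∷ ys                                  ∎)
  where
  y∈xs : 0 < count (_≟ y) xs
  y∈xs = subst (0 <_) (sym (trans (same y) (count-yes (_≟ y) ys refl))) z<s
  same′ : ∀ j → lookup xs j ≡ y → ∀ a → count (_≟ a) (removeAt xs j) ≡ count (_≟ a) ys
  same′ j xⱼ≡y a = count-∷-cancel (_≟ a) y (removeAt xs j) ys (begin
    count (_≟ a) (y ∷ removeAt xs j)           ≡⟨ cong (λ x → count (_≟ a) (x ∷ removeAt xs j)) xⱼ≡y ⟨
    count (_≟ a) (lookup xs j ∷ removeAt xs j) ≡⟨ count-removeAt (_≟ a) xs j ⟨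
    count (_≟ a) xs                            ≡⟨ same a ⟩
    count (_≟ a) (y ∷ ys)                      ∎)

-- Subsets as vectors over Z₂

⊕-assoc : ∀ (p q r : Vec Bool n) → (p ⊕ q) ⊕ r ≡ p ⊕ (q ⊕ r)
⊕-assoc = zipWith-assoc xor-assoc

⊕-comm : ∀ (p q : Vec Bool n) → p ⊕ q ≡ q ⊕ p
⊕-comm = zipWith-comm xor-comm

⊕-identityˡ : ∀ (p : Vec Bool n) → replicate n false ⊕ p ≡ p
⊕-identityˡ = zipWith-identityˡ xor-identityˡ

⊕-self : ∀ (p : Vec Bool n) → p ⊕ p ≡ replicate n false
⊕-self []      = refl
⊕-self (b ∷ p) = cong₂ _∷_ (xor-same b) (⊕-self p)

⊕-cancelˡ : ∀ (p q : Vec Bool n) → p ⊕ (p ⊕ q) ≡ q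
⊕-cancelˡ p q = begin
  p ⊕ (p ⊕ q)           ≡⟨ ⊕-assoc p p q ⟨
  (p ⊕ p) ⊕ q           ≡⟨ cong (_⊕ q) (⊕-self p) ⟩
  replicate _ false ⊕ q ≡⟨ ⊕-identityˡ q ⟩
  q                     ∎

⊕-interchange : ∀ (p q r s : Vec Bool n) → (p ⊕ q) ⊕ (r ⊕ s) ≡ (p ⊕ r) ⊕ (q ⊕ s)
⊕-interchange p q r s = begin
  (p ⊕ q) ⊕ (r ⊕ s) ≡⟨ ⊕-assoc p q (r ⊕ s) ⟩
  p ⊕ (q ⊕ (r ⊕ s)) ≡⟨ cong (p ⊕_) (⊕-assoc q r s) ⟨
  p ⊕ ((q ⊕ r) ⊕ s) ≡⟨ cong (λ t → p ⊕ (t ⊕ s)) (⊕-comm q r) ⟩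
  p ⊕ ((r ⊕ q) ⊕ s) ≡⟨ cong (p ⊕_) (⊕-assoc r q s) ⟩
  p ⊕ (r ⊕ (q ⊕ s)) ≡⟨ ⊕-assoc p r (q ⊕ s) ⟨
  (p ⊕ r) ⊕ (q ⊕ s) ∎

∁[_] : Bool → Subset n → Subset n
∁[ f ] p = replicate _ f ⊕ p

∁[false] : ∀ (p : Subset n) → ∁[ false ] p ≡ p
∁[false] = ⊕-identityˡ

∁[true] : ∀ (p : Subset n) → ∁[ true ] p ≡ ∁ p
∁[true] = zipWith-replicate₁ _xor_ true

∁[]-involutive : ∀ f (p : Subset n) → ∁[ f ] (∁[ f ] p) ≡ p
∁[]-involutive f = ⊕-cancelˡ (replicate _ f)

∁[]-∁[] : ∀ f g (p : Subset n) → ∁[ f ] (∁[ g ] p) ≡ ∁[ f xor g ] p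
∁[]-∁[] f g p = trans (sym (⊕-assoc _ _ p)) (cong (_⊕ p) (zipWith-replicate _xor_ f g))

∁[]-⊕ : ∀ f g (p q : Subset n) → ∁[ f ] p ⊕ ∁[ g ] q ≡ ∁[ f xor g ] (p ⊕ q)
∁[]-⊕ f g p q = trans (⊕-interchange _ p _ q) (cong (_⊕ (p ⊕ q)) (zipWith-replicate _xor_ f g))

permute-⊕ : ∀ (π : Permutation′ n) (p q : Subset n) → permute π (p ⊕ q) ≡ permute π p ⊕ permute π q
permute-⊕ = permute-zipWith _xor_

permute-∁[] : ∀ (π : Permutation′ n) f (p : Subset n) → permute π (∁[ f ] p) ≡ ∁[ f ] (permute π p)
permute-∁[] π f p = trans (permute-⊕ π (replicate _ f) p) (cong (_⊕ permute π p) (permute-replicate π f))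

∣permute∣ : ∀ (π : Permutation′ n) (p : Subset n) → ∣ permute π p ∣ ≡ ∣ p ∣
∣permute∣ π = count-permute (_≟ inside) π

∣∁p∣≡∣∁q∣⇒∣p∣≡∣q∣ : ∀ (p q : Subset n) → ∣ ∁ p ∣ ≡ ∣ ∁ q ∣ → ∣ p ∣ ≡ ∣ q ∣
∣∁p∣≡∣∁q∣⇒∣p∣≡∣q∣ p q eq =
  ∸-cancelˡ-≡ (∣p∣≤n p) (∣p∣≤n q) (trans (sym (∣∁p∣≡n∸∣p∣ p)) (trans eq (∣∁p∣≡n∸∣p∣ q)))

_≟²_ : DecidableEquality (Bool × Bool)
_≟²_ = ≡-dec _≟_ _≟_

jointCount : Bool → Bool → Subset n → Subset n → ℕ
jointCount a b p q = count (_≟² (a , b)) (zip p q)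

∣p∣-jointCount : ∀ (p q : Subset n) → ∣ p ∣ ≡ jointCount true true p q + jointCount true false p q
∣p∣-jointCount []          []          = refl
∣p∣-jointCount (true ∷ p)  (true ∷ q)  = cong suc (∣p∣-jointCount p q)
∣p∣-jointCount (true ∷ p)  (false ∷ q) = trans (cong suc (∣p∣-jointCount p q)) (sym (+-suc _ _))
∣p∣-jointCount (false ∷ p) (_ ∷ q)     = ∣p∣-jointCount p q

∣q∣-jointCount : ∀ (p q : Subset n) → ∣ q ∣ ≡ jointCount true true p q + jointCount false true p q
∣q∣-jointCount []          []          = refl
∣q∣-jointCount (true ∷ p)  (true ∷ q)  = cong suc (∣q∣-jointCount p q)
∣q∣-jointCount (false ∷ p) (true ∷ q)  = trans (cong suc (∣q∣-jointCount p q)) (sym (+-suc _ _))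
∣q∣-jointCount (true ∷ p)  (false ∷ q) = ∣q∣-jointCount p q
∣q∣-jointCount (false ∷ p) (false ∷ q) = ∣q∣-jointCount p q

∣p⊕q∣-jointCount : ∀ (p q : Subset n) → ∣ p ⊕ q ∣ ≡ jointCount true false p q + jointCount false true p q
∣p⊕q∣-jointCount []          []          = refl
∣p⊕q∣-jointCount (true ∷ p)  (false ∷ q) = cong suc (∣p⊕q∣-jointCount p q)
∣p⊕q∣-jointCount (false ∷ p) (true ∷ q)  = trans (cong suc (∣p⊕q∣-jointCount p q)) (sym (+-suc _ _))
∣p⊕q∣-jointCount (true ∷ p)  (true ∷ q)  = ∣p⊕q∣-jointCount p q
∣p⊕q∣-jointCount (false ∷ p) (false ∷ q) = ∣p⊕q∣-jointCount p q

n-jointCount : ∀ (p q : Subset n) → n ≡ ∣ p ∣ + jointCount false true p q + jointCount false false p q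
n-jointCount []          []          = refl
n-jointCount (true ∷ p)  (_ ∷ q)     = cong suc (n-jointCount p q)
n-jointCount (false ∷ p) (true ∷ q)  =
  trans (cong suc (n-jointCount p q)) (sym (cong (_+ jointCount false false p q) (+-suc ∣ p ∣ _)))
n-jointCount (false ∷ p) (false ∷ q) = trans (cong suc (n-jointCount p q)) (sym (+-suc _ _))

pairwise-sums-injective : ∀ {d b c d′ b′ c′} → d + b ≡ d′ + b′ → d + c ≡ d′ + c′ → b + c ≡ b′ + c′ →
                          d ≡ d′ × b ≡ b′ × c ≡ c′
pairwise-sums-injective {d} {b} {c} {d′} {b′} {c′} db dc bc =
  d≡d′ , +-cancelˡ-≡ d b b′ (trans db (cong (_+ b′) (sym d≡d′)))
       , +-cancelˡ-≡ d c c′ (trans dc (cong (_+ c′) (sym d≡d′)))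
  where
  twice-plus : ∀ d b c → 2 * d + (b + c) ≡ (d + b) + (d + c)
  twice-plus = solve-∀
  d≡d′ : d ≡ d′
  d≡d′ = *-cancelˡ-≡ d d′ 2 (+-cancelʳ-≡ (b + c) (2 * d) (2 * d′) (begin
    2 * d + (b + c)       ≡⟨ twice-plus d b c ⟩
    (d + b) + (d + c)     ≡⟨ cong₂ _+_ db dc ⟩
    (d′ + b′) + (d′ + c′) ≡⟨ twice-plus d′ b′ c′ ⟨
    2 * d′ + (b′ + c′)    ≡⟨ cong (2 * d′ +_) bc ⟨
    2 * d′ + (b + c)      ∎))

jointCount-determined : ∀ (p q p′ q′ : Subset n) → ∣ p ∣ ≡ ∣ p′ ∣ → ∣ q ∣ ≡ ∣ q′ ∣ → ∣ p ⊕ q ∣ ≡ ∣ p′ ⊕ q′ ∣ →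
                        ∀ a b → jointCount a b p q ≡ jointCount a b p′ q′
jointCount-determined p q p′ q′ ∣p∣ ∣q∣ ∣p⊕q∣ = same
  where
  # #′ : Bool → Bool → ℕ
  # a b = jointCount a b p q
  #′ a b = jointCount a b p′ q′
  sums : # true true ≡ #′ true true × # true false ≡ #′ true false × # false true ≡ #′ false true
  sums = pairwise-sums-injective
    (trans (sym (∣p∣-jointCount p q)) (trans ∣p∣ (∣p∣-jointCount p′ q′)))
    (trans (sym (∣q∣-jointCount p q)) (trans ∣q∣ (∣q∣-jointCount p′ q′)))
    (trans (sym (∣p⊕q∣-jointCount p q)) (trans ∣p⊕q∣ (∣p⊕q∣-jointCount p′ q′)))
  same : ∀ a b → # a b ≡ #′ a b
  same true  true  = proj₁ sums
  same true  false = proj₁ (proj₂ sums)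
  same false true  = proj₂ (proj₂ sums)
  same false false = +-cancelˡ-≡ (∣ p ∣ + # false true) _ _ (begin
    ∣ p ∣ + # false true + # false false    ≡⟨ n-jointCount p q ⟨
    _                                       ≡⟨ n-jointCount p′ q′ ⟩
    ∣ p′ ∣ + #′ false true + #′ false false ≡⟨ cong₂ (λ l m → l + m + #′ false false) ∣p∣ (same false true) ⟨
    ∣ p ∣ + # false true + #′ false false   ∎)

permute-pair-of-weights : ∀ (p q p′ q′ : Subset n) →
                          ∣ p ∣ ≡ ∣ p′ ∣ → ∣ q ∣ ≡ ∣ q′ ∣ → ∣ p ⊕ q ∣ ≡ ∣ p′ ⊕ q′ ∣ →
                          ∃ λ π → permute π p ≡ p′ × permute π q ≡ q′
permute-pair-of-weights p q p′ q′ ∣p∣ ∣q∣ ∣p⊕q∣ =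
  let π , π-zip = permute-of-counts _≟²_ (zip p q) (zip p′ q′) same in
  π , project π π-zip proj₁ (map-proj₁-zip p q) (map-proj₁-zip p′ q′)
    , project π π-zip proj₂ (map-proj₂-zip p q) (map-proj₂-zip p′ q′)
  where
  same : ∀ ab → count (_≟² ab) (zip p q) ≡ count (_≟² ab) (zip p′ q′)
  same (a , b) = jointCount-determined p q p′ q′ ∣p∣ ∣q∣ ∣p⊕q∣ a b
  project : ∀ π {r r′} → permute π (zip p q) ≡ zip p′ q′ → ∀ (f : Bool × Bool → Bool) →
            map f (zip p q) ≡ r → map f (zip p′ q′) ≡ r′ → permute π r ≡ r′
  project π π-zip f refl refl = trans (permute-map f π (zip p q)) (cong (map f) π-zip)

-- The signed projective cube

m≡n⇔1+n∸m≡1 : ∀ {m n} → m ≤ n → (m ≡ n) ⇔ (suc n ∸ m ≡ 1)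
m≡n⇔1+n∸m≡1 {m} {n} m≤n = mk⇔
  (λ { refl → m+n∸n≡m 1 m })
  (λ eq → ∸-cancelˡ-≡ (m≤n⇒m≤1+n m≤n) (m≤n⇒m≤1+n ≤-refl) (trans eq (sym (m+n∸n≡m 1 n))))

≡-cong⇔ : ∀ {m m′ c : ℕ} → m ≡ m′ → (m ≡ c) ⇔ (m′ ≡ c)
≡-cong⇔ eq = mk⇔ (trans (sym eq)) (trans eq)

xor-cycle : ∀ a b c → (a xor b) xor (c xor a) ≡ b xor c
xor-cycle false b     c     = cong (b xor_) (xor-identityʳ c)
xor-cycle true  true  true  = refl
xor-cycle true  true  false = refl
xor-cycle true  false true  = refl
xor-cycle true  false false = refl

module _ {k : ℕ} where

  ham≡∣⊕∣ : ∀ (p q : Vertex k) → ham p q ≡ ∣ p ⊕ q ∣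
  ham≡∣⊕∣ p q = count-cong _ (_≟ inside) (p ⊕ q)

  S⁺≡outside∷⊕ : ∀ (p q : Vertex k) → S⁺ p q ≡ outside ∷ (p ⊕ q)
  S⁺≡outside∷⊕ p q =
    cong (outside ∷_) (trans (map-cong (λ { true → refl ; false → refl }) (p ⊕ q)) (map-id (p ⊕ q)))

  S⁻≡∁S⁺ : ∀ (p q : Vertex k) → S⁻ p q ≡ ∁ (S⁺ p q)
  S⁻≡∁S⁺ p q =
    cong (inside ∷_) (trans (map-cong (λ { true → refl ; false → refl }) (p ⊕ q)) (map-∘ not _ (p ⊕ q)))

  switchedS⁻≡∁∁[]S⁺ : ∀ f (p q : Vertex k) → switchedS⁻ f p q ≡ ∁ (∁[ f ] (S⁺ p q))
  switchedS⁻≡∁∁[]S⁺ true  p q = sym (trans (sym (∁[true] (∁[ true ] (S⁺ p q)))) (∁[]-involutive true (S⁺ p q)))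
  switchedS⁻≡∁∁[]S⁺ false p q = trans (S⁻≡∁S⁺ p q) (cong ∁ (sym (∁[false] (S⁺ p q))))

  ∣switchedS⁻∣≡∣S⁻∣⇒∣∁[]S⁺∣≡∣S⁺∣ : ∀ f (p q r s : Vertex k) → ∣ switchedS⁻ f p q ∣ ≡ ∣ S⁻ r s ∣ →
                                    ∣ ∁[ f ] (S⁺ p q) ∣ ≡ ∣ S⁺ r s ∣
  ∣switchedS⁻∣≡∣S⁻∣⇒∣∁[]S⁺∣≡∣S⁺∣ f p q r s eq = ∣∁p∣≡∣∁q∣⇒∣p∣≡∣q∣ (∁[ f ] (S⁺ p q)) (S⁺ r s) (begin
    ∣ ∁ (∁[ f ] (S⁺ p q)) ∣ ≡⟨ cong ∣_∣ (switchedS⁻≡∁∁[]S⁺ f p q) ⟨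
    ∣ switchedS⁻ f p q ∣    ≡⟨ eq ⟩
    ∣ S⁻ r s ∣              ≡⟨ cong ∣_∣ (S⁻≡∁S⁺ r s) ⟩
    ∣ ∁ (S⁺ r s) ∣          ∎)

  ∣S⁺∣≡ham : ∀ (p q : Vertex k) → ∣ S⁺ p q ∣ ≡ ham p q
  ∣S⁺∣≡ham p q = trans (cong ∣_∣ (S⁺≡outside∷⊕ p q)) (sym (ham≡∣⊕∣ p q))

  S⁺-self : ∀ (p : Vertex k) → S⁺ p p ≡ ⊥
  S⁺-self p = trans (S⁺≡outside∷⊕ p p) (cong (outside ∷_) (⊕-self p))

  S⁺-comm : ∀ (p q : Vertex k) → S⁺ p q ≡ S⁺ q p
  S⁺-comm p q = cong (λ r → outside ∷ map _ r) (⊕-comm p q)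

  S⁺-⊕ : ∀ (x p q : Vertex k) → S⁺ x p ⊕ S⁺ x q ≡ S⁺ p q
  S⁺-⊕ x p q = begin
    S⁺ x p ⊕ S⁺ x q                         ≡⟨ cong₂ _⊕_ (S⁺≡outside∷⊕ x p) (S⁺≡outside∷⊕ x q) ⟩
    outside ∷ ((x ⊕ p) ⊕ (x ⊕ q))           ≡⟨ cong (outside ∷_) (⊕-interchange x p x q) ⟩
    outside ∷ ((x ⊕ x) ⊕ (p ⊕ q))           ≡⟨ cong (λ r → outside ∷ (r ⊕ (p ⊕ q))) (⊕-self x) ⟩
    outside ∷ (replicate k false ⊕ (p ⊕ q)) ≡⟨ cong (outside ∷_) (⊕-identityˡ (p ⊕ q)) ⟩
    outside ∷ (p ⊕ q)                       ≡⟨ S⁺≡outside∷⊕ p q ⟨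
    S⁺ p q                                  ∎

  -- The sum in Z₂ᵏ of the elements of a subset of S_k.
  subsetSum : Subset (suc k) → Vertex k
  subsetSum (b ∷ w) = ∁[ b ] w

  subsetSum-S⁺ : ∀ (p q : Vertex k) → subsetSum (S⁺ p q) ≡ p ⊕ q
  subsetSum-S⁺ p q = trans (cong subsetSum (S⁺≡outside∷⊕ p q)) (∁[false] (p ⊕ q))

  subsetSum-∁[] : ∀ f (R : Subset (suc k)) → subsetSum (∁[ f ] R) ≡ subsetSum R
  subsetSum-∁[] f (b ∷ w) = begin
    ∁[ f xor b ] (∁[ f ] w)      ≡⟨ cong (λ g → ∁[ g ] (∁[ f ] w)) (xor-comm f b) ⟩
    ∁[ b xor f ] (∁[ f ] w)      ≡⟨ ∁[]-∁[] b f (∁[ f ] w) ⟨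
    ∁[ b ] (∁[ f ] (∁[ f ] w))   ≡⟨ cong ∁[ b ] (∁[]-involutive f w) ⟩
    ∁[ b ] w                     ∎

  subset≡∁[head]S⁺ : ∀ (u : Vertex k) (R : Subset (suc k)) → R ≡ ∁[ head R ] (S⁺ u (u ⊕ subsetSum R))
  subset≡∁[head]S⁺ u (b ∷ w) = sym (begin
    ∁[ b ] (S⁺ u (u ⊕ ∁[ b ] w))       ≡⟨ cong ∁[ b ] (S⁺≡outside∷⊕ u (u ⊕ ∁[ b ] w)) ⟩
    ∁[ b ] (outside ∷ (u ⊕ (u ⊕ ∁[ b ] w))) ≡⟨ cong (λ r → ∁[ b ] (outside ∷ r)) (⊕-cancelˡ u (∁[ b ] w)) ⟩
    (b xor false) ∷ ∁[ b ] (∁[ b ] w)  ≡⟨ cong₂ _∷_ (xor-identityʳ b) (∁[]-involutive b w) ⟩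
    b ∷ w                              ∎)

  Edge⇔∣∁[]S⁺∣≡1 : ∀ s (p q : Vertex k) → Edge k s p q ⇔ ∣ ∁[ s ] (S⁺ p q) ∣ ≡ 1
  Edge⇔∣∁[]S⁺∣≡1 false p q = ≡-cong⇔ (sym (trans (cong ∣_∣ (∁[false] (S⁺ p q))) (∣S⁺∣≡ham p q)))
  Edge⇔∣∁[]S⁺∣≡1 true  p q = ⇔.trans (m≡n⇔1+n∸m≡1 ham≤k) (≡-cong⇔ (sym (begin
    ∣ ∁[ true ] (S⁺ p q) ∣ ≡⟨ cong ∣_∣ (∁[true] (S⁺ p q)) ⟩
    ∣ ∁ (S⁺ p q) ∣         ≡⟨ ∣∁p∣≡n∸∣p∣ (S⁺ p q) ⟩
    suc k ∸ ∣ S⁺ p q ∣     ≡⟨ cong (suc k ∸_) (∣S⁺∣≡ham p q) ⟩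
    suc k ∸ ham p q        ∎)))
    where
    ham≤k : ham p q ≤ k
    ham≤k = subst (_≤ k) (sym (ham≡∣⊕∣ p q)) (∣p∣≤n (p ⊕ q))

  isAutomorphism-of-permute : ∀ (φ : Vertex k ⤖ Vertex k) (σ : Vertex k → Bool) (π : Permutation′ (suc k)) →
    (∀ p q → permute π (S⁺ p q) ≡ ∁[ σ p xor σ q ] (S⁺ (Bijection.to φ p) (Bijection.to φ q))) →
    IsAutomorphism k φ
  isAutomorphism-of-permute φ σ π πS⁺ = σ , λ s p q →
    ⇔.trans (Edge⇔∣∁[]S⁺∣≡1 s p q)
      (⇔.trans (≡-cong⇔ (weight s p q)) (⇔.sym (Edge⇔∣∁[]S⁺∣≡1 (s xor σ p xor σ q) (f p) (f q))))
    where
    f : Vertex k → Vertex k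
    f = Bijection.to φ
    weight : ∀ s p q → ∣ ∁[ s ] (S⁺ p q) ∣ ≡ ∣ ∁[ s xor σ p xor σ q ] (S⁺ (f p) (f q)) ∣
    weight s p q = begin
      ∣ ∁[ s ] (S⁺ p q) ∣                            ≡⟨ ∣permute∣ π (∁[ s ] (S⁺ p q)) ⟨
      ∣ permute π (∁[ s ] (S⁺ p q)) ∣                ≡⟨ cong ∣_∣ (permute-∁[] π s (S⁺ p q)) ⟩
      ∣ ∁[ s ] (permute π (S⁺ p q)) ∣                ≡⟨ cong (∣_∣ ∘ ∁[ s ]) (πS⁺ p q) ⟩
      ∣ ∁[ s ] (∁[ σ p xor σ q ] (S⁺ (f p) (f q))) ∣ ≡⟨ cong ∣_∣ (∁[]-∁[] s (σ p xor σ q) (S⁺ (f p) (f q))) ⟩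
      ∣ ∁[ s xor σ p xor σ q ] (S⁺ (f p) (f q)) ∣    ∎

module Relabel {k} (π : Permutation′ (suc k)) (x u : Vertex k) where

  relabel : Vertex k → Vertex k
  relabel p = u ⊕ subsetSum (permute π (S⁺ x p))

  switching : Vertex k → Bool
  switching p = head (permute π (S⁺ x p))

  permute-S⁺-base : ∀ p → permute π (S⁺ x p) ≡ ∁[ switching p ] (S⁺ u (relabel p))
  permute-S⁺-base p = subset≡∁[head]S⁺ u (permute π (S⁺ x p))

  permute-S⁺ : ∀ p q → permute π (S⁺ p q) ≡ ∁[ switching p xor switching q ] (S⁺ (relabel p) (relabel q))
  permute-S⁺ p q = begin
    permute π (S⁺ p q)
      ≡⟨ cong (permute π) (S⁺-⊕ x p q) ⟨
    permute π (S⁺ x p ⊕ S⁺ x q)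
      ≡⟨ permute-⊕ π (S⁺ x p) (S⁺ x q) ⟩
    permute π (S⁺ x p) ⊕ permute π (S⁺ x q)
      ≡⟨ cong₂ _⊕_ (permute-S⁺-base p) (permute-S⁺-base q) ⟩
    ∁[ switching p ] (S⁺ u (relabel p)) ⊕ ∁[ switching q ] (S⁺ u (relabel q))
      ≡⟨ ∁[]-⊕ (switching p) (switching q) (S⁺ u (relabel p)) (S⁺ u (relabel q)) ⟩
    ∁[ switching p xor switching q ] (S⁺ u (relabel p) ⊕ S⁺ u (relabel q))
      ≡⟨ cong ∁[ switching p xor switching q ] (S⁺-⊕ u (relabel p) (relabel q)) ⟩
    ∁[ switching p xor switching q ] (S⁺ (relabel p) (relabel q))
      ∎

  relabel-unique : ∀ f {p r} → permute π (∁[ f ] (S⁺ x p)) ≡ S⁺ u r → relabel p ≡ r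
  relabel-unique f {p} {r} eq = begin
    u ⊕ subsetSum (permute π (S⁺ x p))          ≡⟨ cong (u ⊕_) (subsetSum-∁[] f (permute π (S⁺ x p))) ⟨
    u ⊕ subsetSum (∁[ f ] (permute π (S⁺ x p))) ≡⟨ cong (λ R → u ⊕ subsetSum R) (permute-∁[] π f (S⁺ x p)) ⟨
    u ⊕ subsetSum (permute π (∁[ f ] (S⁺ x p))) ≡⟨ cong (λ R → u ⊕ subsetSum R) eq ⟩
    u ⊕ subsetSum (S⁺ u r)                      ≡⟨ cong (u ⊕_) (subsetSum-S⁺ u r) ⟩
    u ⊕ (u ⊕ r)                                 ≡⟨ ⊕-cancelˡ u r ⟩
    r                                           ∎

  relabel-base : relabel x ≡ u
  relabel-base = relabel-unique false (begin
    permute π (∁[ false ] (S⁺ x x)) ≡⟨ cong (permute π) (trans (∁[false] (S⁺ x x)) (S⁺-self x)) ⟩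
    permute π ⊥                     ≡⟨ permute-replicate π false ⟩
    ⊥                               ≡⟨ S⁺-self u ⟨
    S⁺ u u                          ∎)

open Relabel

relabel-inverse : ∀ {k} (π ρ : Permutation′ (suc k)) (x u : Vertex k) →
                  (∀ R → permute π (permute ρ R) ≡ R) → ∀ r → relabel π x u (relabel ρ u x r) ≡ r
relabel-inverse π ρ x u πρ r = relabel-unique π x u (switching ρ u x r) (begin
  permute π (∁[ switching ρ u x r ] (S⁺ x (relabel ρ u x r))) ≡⟨ cong (permute π) (permute-S⁺-base ρ u x r) ⟨
  permute π (permute ρ (S⁺ u r))                               ≡⟨ πρ (S⁺ u r) ⟩
  S⁺ u r                                                       ∎)

relabel-bijection : ∀ {k} → Permutation′ (suc k) → Vertex k → Vertex k → Vertex k ⤖ Vertex k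
relabel-bijection π x u = ↔⇒⤖ (mk↔ₛ′ (relabel π x u) (relabel (flip π) u x)
  (relabel-inverse π (flip π) x u (permute-inverse π (flip π) (λ _ → inverseˡ π)))
  (relabel-inverse (flip π) π u x (permute-inverse (flip π) π (λ _ → inverseʳ π))))

relabel-isAutomorphism : ∀ {k} (π : Permutation′ (suc k)) (x u : Vertex k) →
                         IsAutomorphism k (relabel-bijection π x u)
relabel-isAutomorphism π x u =
  isAutomorphism-of-permute (relabel-bijection π x u) (switching π x u) π (permute-S⁺ π x u)

theorem4 : (k : ℕ) → 1 ≤ k → (x y z u v t : Vertex k) →
    x ≢ y → y ≢ z → z ≢ x → u ≢ v → v ≢ t → t ≢ u →
    (Σ Bool λ a → Σ Bool λ b → Σ Bool λ c →
       (∣ switchedS⁻ (a xor b) x y ∣ ≡ ∣ S⁻ u v ∣) ×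
       (∣ switchedS⁻ (b xor c) y z ∣ ≡ ∣ S⁻ v t ∣) ×
       (∣ switchedS⁻ (c xor a) z x ∣ ≡ ∣ S⁻ t u ∣)) →
    Σ (Vertex k ⤖ Vertex k) λ φ → IsAutomorphism k φ ×
      (Bijection.to φ x ≡ u) × (Bijection.to φ y ≡ v) × (Bijection.to φ z ≡ t)
theorem4 k _ x y z u v t _ _ _ _ _ _ (a , b , c , xy , yz , zx) =
  let π , πSy , πSz = permute-pair-of-weights Sy Sz (S⁺ u v) (S⁺ u t) ∣Sy∣ ∣Sz∣ ∣Sy⊕Sz∣ in
  relabel-bijection π x u , relabel-isAutomorphism π x u ,
  relabel-base π x u , relabel-unique π x u (a xor b) πSy , relabel-unique π x u (c xor a) πSz
  where
  Sy Sz : Subset (suc k)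
  Sy = ∁[ a xor b ] (S⁺ x y)
  Sz = ∁[ c xor a ] (S⁺ x z)
  ∣Sy∣ : ∣ Sy ∣ ≡ ∣ S⁺ u v ∣
  ∣Sy∣ = ∣switchedS⁻∣≡∣S⁻∣⇒∣∁[]S⁺∣≡∣S⁺∣ (a xor b) x y u v xy
  ∣Sz∣ : ∣ Sz ∣ ≡ ∣ S⁺ u t ∣
  ∣Sz∣ = subst₂ (λ R R′ → ∣ ∁[ c xor a ] R ∣ ≡ ∣ R′ ∣) (S⁺-comm z x) (S⁺-comm t u)
          (∣switchedS⁻∣≡∣S⁻∣⇒∣∁[]S⁺∣≡∣S⁺∣ (c xor a) z x t u zx)
  ∣Sy⊕Sz∣ : ∣ Sy ⊕ Sz ∣ ≡ ∣ S⁺ u v ⊕ S⁺ u t ∣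
  ∣Sy⊕Sz∣ = begin
    ∣ Sy ⊕ Sz ∣
      ≡⟨ cong ∣_∣ (∁[]-⊕ (a xor b) (c xor a) (S⁺ x y) (S⁺ x z)) ⟩
    ∣ ∁[ (a xor b) xor (c xor a) ] (S⁺ x y ⊕ S⁺ x z) ∣
      ≡⟨ cong₂ (λ f R → ∣ ∁[ f ] R ∣) (xor-cycle a b c) (S⁺-⊕ x y z) ⟩
    ∣ ∁[ b xor c ] (S⁺ y z) ∣
      ≡⟨ ∣switchedS⁻∣≡∣S⁻∣⇒∣∁[]S⁺∣≡∣S⁺∣ (b xor c) y z v t yz ⟩
    ∣ S⁺ v t ∣
      ≡⟨ cong ∣_∣ (S⁺-⊕ u v t) ⟨
    ∣ S⁺ u v ⊕ S⁺ u t ∣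
      ∎
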